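{- Let $G$ be a directed acyclic multigraph with single source $s$ and single sink $t$. Then: (1) for every non-negative integer flow $f$ on $G$, $\mathrm{width}(G|_f)\le \mathrm{fwidth}(G,f)\le \mathrm{MFD}_{\mathbb{N}}(G,f)$; (2) for all non-negative integer flows $g\ge f\ge 0$ on $G$ with $G|_g=G|_f$, $\mathrm{fwidth}(G,f)\ge \mathrm{fwidth}(G,g)$.
   Context: A flow is $f:E(G)\to\mathbb{N}$ with conservation at vertices other than $s,t$; $f\le g$ means $f(e)\le g(e)$ for all edges. The flow-subgraph $G|_f$ has edge set $\{e:f(e)>0\}$ and vertex set $V(G)$ minus the vertices whose total incoming and total outgoing flow are both $0$. $\mathrm{width}(H)$ is the minimum number of source-to-sink paths covering all edges of $H$. The flow-width $\mathrm{fwidth}(G,f)$ is the smallest number of $s$-$t$ paths such that every edge with $f(e)>0$ lies on at least one path and every edge $e$ lies on at most $f(e)$ paths. $\mathrm{MFD}_{\mathbb{N}}(G,f)$ is the minimum $k$ such that there are $s$-$t$ paths $P_1,\dots,P_k$ and weights $w_i\in\mathbb{N}$ with $f=\sum_iw_iP_i$ (paths as edge-indicator functions). -}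

module Defs where

open import Data.Nat using (ℕ; zero; suc; _+_; _*_; _≤_; _<_)
open import Data.Fin using (Fin; zero; suc)
import Data.Fin as Fin
open import Data.Bool using (Bool; true; false; if_then_else_; _∨_)
open import Data.List using (List; []; _∷_)
open import Data.List.Membership.Propositional using (_∈_)
open import Data.Product using (Σ; ∃; _×_; _,_)
open import Data.Sum using (_⊎_)
open import Relation.Nullary using (¬_; does)
open import Relation.Binary.PropositionalEquality using (_≡_)

∑ : (n : ℕ) → (Fin n → ℕ) → ℕ
∑ zero    h = 0
∑ (suc n) h = h zero + ∑ n (λ i → h (suc i))

record Multigraph : Set where
  field
    V   : ℕ
    E   : ℕ
    src : Fin E → Fin V
    tgt : Fin E → Fin V
open Multigraph public

module _ (G : Multigraph) where

  Vertex : Set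
  Vertex = Fin (V G)

  Edge : Set
  Edge = Fin (E G)

  IsWalk : Vertex → Vertex → List Edge → Set
  IsWalk u w []       = u ≡ w
  IsWalk u w (e ∷ es) = src G e ≡ u × IsWalk (tgt G e) w es

  Acyclic : Set
  Acyclic = ∀ v es → IsWalk v v es → es ≡ []

  IsSource : Vertex → Set
  IsSource v = ∀ e → ¬ (tgt G e ≡ v)

  IsSink : Vertex → Set
  IsSink v = ∀ e → ¬ (src G e ≡ v)

  SingleSourceSink : Vertex → Vertex → Set
  SingleSourceSink s t =
    (∀ v → IsSource v → v ≡ s) × IsSource s ×
    (∀ v → IsSink v → v ≡ t) × IsSink t

  IsDAGst : Vertex → Vertex → Set
  IsDAGst s t = Acyclic × SingleSourceSink s t

  FlowFn : Set
  FlowFn = Edge → ℕ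

  inflow : FlowFn → Vertex → ℕ
  inflow f v = ∑ (E G) (λ e → if does (tgt G e Fin.≟ v) then f e else 0)

  outflow : FlowFn → Vertex → ℕ
  outflow f v = ∑ (E G) (λ e → if does (src G e Fin.≟ v) then f e else 0)

  IsFlow : Vertex → Vertex → FlowFn → Set
  IsFlow s t f = ∀ v → ¬ (v ≡ s) → ¬ (v ≡ t) → inflow f v ≡ outflow f v

  _≤F_ : FlowFn → FlowFn → Set
  f ≤F g = ∀ e → f e ≤ g e

  -- s-t paths (in a DAG every walk is a path).
  IsSTPath : Vertex → Vertex → List Edge → Set
  IsSTPath s t P = IsWalk s t P

  memb : Edge → List Edge → Bool
  memb e []       = false
  memb e (x ∷ xs) = does (e Fin.≟ x) ∨ memb e xs

  ind : List Edge → Edge → ℕ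
  ind P e = if memb e P then 1 else 0

  module FlowSubgraph (f : FlowFn) where
    HEdge : Edge → Set
    HEdge e = 0 < f e

    HVertex : Vertex → Set
    HVertex v = 0 < inflow f v ⊎ 0 < outflow f v

    HSource : Vertex → Set
    HSource v = HVertex v × (∀ e → tgt G e ≡ v → ¬ HEdge e)

    HSink : Vertex → Set
    HSink v = HVertex v × (∀ e → src G e ≡ v → ¬ HEdge e)

    IsHPath : List Edge → Set
    IsHPath P = Σ Vertex λ u → Σ Vertex λ w →
      HSource u × HSink w × IsWalk u w P × (∀ e → e ∈ P → HEdge e)

  WidthWitness : FlowFn → ℕ → Set
  WidthWitness f k = Σ (Fin k → List Edge) λ P →
    (∀ i → FlowSubgraph.IsHPath f (P i)) ×
    (∀ e → FlowSubgraph.HEdge f e → ∃ λ i → e ∈ P i)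

  FWidthWitness : Vertex → Vertex → FlowFn → ℕ → Set
  FWidthWitness s t f k = Σ (Fin k → List Edge) λ P →
    (∀ i → IsSTPath s t (P i)) ×
    (∀ e → 0 < f e → ∃ λ i → e ∈ P i) ×
    (∀ e → ∑ k (λ i → ind (P i) e) ≤ f e)

  MFDWitness : Vertex → Vertex → FlowFn → ℕ → Set
  MFDWitness s t f k = Σ (Fin k → List Edge) λ P → Σ (Fin k → ℕ) λ w →
    (∀ i → IsSTPath s t (P i)) ×
    (∀ e → f e ≡ ∑ k (λ i → w i * ind (P i) e))


-- "min {k | A k} ≤ min {k | B k}" for predicates on ℕ
-- (for every B-witness there is an A-witness no larger).
MinLe : (ℕ → Set) → (ℕ → Set) → Set
MinLe A B = ∀ k → B k → ∃ λ j → A j × j ≤ k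

{-# OPTIONS --safe #-}
-- An fwidth witness uses only edges of positive flow, since each edge lies on
-- at most f(e) of its paths. When s ≠ t each of its paths leaves s and enters
-- t along such edges; s and t have no incoming resp. outgoing edges in G at
-- all, so they are a source and a sink of G|_f and the paths form a width
-- witness. When s = t acyclicity makes every s-t path empty, so f vanishes and
-- the empty family witnesses width 0. Discarding the zero-weight paths of an
-- MFD decomposition leaves an fwidth witness, each remaining weight being at
-- least 1. Finally, an fwidth witness for f is one for g ≥ f of the same support.
module Submission where

open import Defs
open import Data.Bool using (true; if_then_else_; _∨_)
open import Data.Bool.Properties using (∨-zeroʳ)
open import Data.Empty using (⊥-elim)
open import Data.Fin using (Fin; zero; suc)
import Data.Fin as Fin
open import Data.List using (List; []; _∷_)
open import Data.List.Membership.Propositional using (_∈_)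
open import Data.List.Relation.Unary.Any using (here; there)
open import Data.List.Relation.Unary.Any.Properties using (¬Any[])
open import Data.Nat using (ℕ; zero; suc; _*_; _≤_; _<_; z≤n; s≤s; z<s; _<?_; >-nonZero)
open import Data.Nat.Properties
  using (≤-refl; ≤-trans; ≤-reflexive; <-≤-trans; m≤m+n; m≤n+m; m≤n⇒m≤1+n; m≤n*m; +-mono-≤; *-comm)
open import Data.Product using (∃; _×_; _,_)
import Data.Product as Product
open import Data.Sum using (inj₁; inj₂)
open import Function using (_∘_)
open import Function.Bundles using (_⇔_; Equivalence)
open import Relation.Binary.PropositionalEquality using (_≡_; _≢_; refl; sym; subst; cong)
open import Relation.Nullary using (¬_; does; yes; no; contradiction)
open import Relation.Nullary.Decidable using (dec-true)

term≤∑ : ∀ {n} (h : Fin n → ℕ) i → h i ≤ ∑ n h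
term≤∑ h zero    = m≤m+n _ _
term≤∑ h (suc i) = ≤-trans (term≤∑ (h ∘ suc) i) (m≤n+m _ _)

∑>0⇒∃term>0 : ∀ n (h : Fin n → ℕ) → 0 < ∑ n h → ∃ λ i → 0 < h i
∑>0⇒∃term>0 (suc n) h p with h zero in h₀≡
... | suc _ = zero , subst (0 <_) (sym h₀≡) z<s
... | zero with ∑>0⇒∃term>0 n (h ∘ suc) p
...   | i , hᵢ>0 = suc i , hᵢ>0

term≤∑-if : ∀ {n m} (c : Fin n → Fin m) (h : Fin n → ℕ) {i v} → c i ≡ v →
  h i ≤ ∑ n (λ j → if does (c j Fin.≟ v) then h j else 0)
term≤∑-if c h {i} {v} ci≡v =
  subst (_≤ _) selected (term≤∑ (λ j → if does (c j Fin.≟ v) then h j else 0) i)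
  where
  selected : (if does (c i Fin.≟ v) then h i else 0) ≡ h i
  selected rewrite dec-true (c i Fin.≟ v) ci≡v = refl

m*n>0⇒m>0 : ∀ m n → 0 < m * n → 0 < m
m*n>0⇒m>0 (suc _) _ _ = z<s

m*n>0⇒n>0 : ∀ m n → 0 < m * n → 0 < n
m*n>0⇒n>0 m n p = m*n>0⇒m>0 n m (subst (0 <_) (*-comm m n) p)

record SupportEnumeration {k} (w : Fin k → ℕ) : Set where
  field
    size        : ℕ
    index       : Fin size → Fin k
    size≤       : size ≤ k
    covers      : ∀ i → 0 < w i → ∃ λ j → index j ≡ i
    ∑≤weighted  : ∀ h → ∑ size (h ∘ index) ≤ ∑ k (λ i → w i * h i)

enumerate-support : ∀ k (w : Fin k → ℕ) → SupportEnumeration w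
enumerate-support zero    w = record
  { size = 0 ; index = λ () ; size≤ = z≤n ; covers = λ () ; ∑≤weighted = λ _ → z≤n }
enumerate-support (suc k) w with enumerate-support k (w ∘ suc) | 0 <? w zero
... | rest | no w₀≯0 = record
  { size       = size
  ; index      = suc ∘ index
  ; size≤      = m≤n⇒m≤1+n size≤
  ; covers     = λ { zero p → contradiction p w₀≯0
                   ; (suc i) p → Product.map₂ (cong suc) (covers i p) }
  ; ∑≤weighted = λ h → ≤-trans (∑≤weighted (h ∘ suc)) (m≤n+m _ _)
  }
  where open SupportEnumeration rest
... | rest | yes w₀>0 = record
  { size       = suc size
  ; index      = index′
  ; size≤      = s≤s size≤
  ; covers     = λ { zero _ → zero , refl
                   ; (suc i) p → Product.map suc (cong suc) (covers i p) }
  ; ∑≤weighted = λ h → +-mono-≤ (m≤n*m (h zero) (w zero) {{>-nonZero w₀>0}}) (∑≤weighted (h ∘ suc))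
  }
  where
  open SupportEnumeration rest
  index′ : Fin (suc size) → Fin (suc k)
  index′ zero    = zero
  index′ (suc j) = suc (index j)

module _ (G : Multigraph) where

  memb≡true⇒∈ : ∀ {e} P → memb G e P ≡ true → e ∈ P
  memb≡true⇒∈ {e} (x ∷ xs) p with e Fin.≟ x
  ... | yes e≡x = here e≡x
  ... | no  _   = there (memb≡true⇒∈ xs p)

  ∈⇒memb≡true : ∀ {e} {P} → e ∈ P → memb G e P ≡ true
  ∈⇒memb≡true {e} {x ∷ _}  (here e≡x) rewrite dec-true (e Fin.≟ x) e≡x = refl
  ∈⇒memb≡true {e} {x ∷ _}  (there e∈xs) rewrite ∈⇒memb≡true e∈xs = ∨-zeroʳ (does (e Fin.≟ x))

  ∈⇒ind≡1 : ∀ {e} {P} → e ∈ P → ind G P e ≡ 1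
  ∈⇒ind≡1 e∈P rewrite ∈⇒memb≡true e∈P = refl

  ind>0⇒∈ : ∀ {e} P → 0 < ind G P e → e ∈ P
  ind>0⇒∈ {e} P p with memb G e P in eq
  ... | true = memb≡true⇒∈ P eq

  walk-leaves : ∀ {u w P} → IsWalk G u w P → u ≢ w → ∃ λ e → e ∈ P × src G e ≡ u
  walk-leaves {P = []}    u≡w    u≢w = contradiction u≡w u≢w
  walk-leaves {P = e ∷ _} (p , _) _  = e , here refl , p

  walk-enters : ∀ {u w P} → IsWalk G u w P → u ≢ w → ∃ λ e → e ∈ P × tgt G e ≡ w
  walk-enters {P = []}        u≡w        u≢w = contradiction u≡w u≢w
  walk-enters {w = w} {e ∷ _} (_ , walk) _ with tgt G e Fin.≟ w
  ... | yes e↦w = e , here refl , e↦w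
  ... | no  e↛w = Product.map₂ (Product.map₁ there) (walk-enters walk e↛w)

  module _ (s t : Vertex G) (f : FlowFn G) where
    open FlowSubgraph G f

    stWalk⇒HPath : IsSource G s → IsSink G t → s ≢ t → ∀ {P} → IsWalk G s t P →
      (∀ e → e ∈ P → 0 < f e) → IsHPath P
    stWalk⇒HPath source sink s≢t walk positive =
      s , t , (s∈H , λ e e↦s _ → source e e↦s) , (t∈H , λ e t↤e _ → sink e t↤e) , walk , positive
      where
      s∈H : HVertex s
      s∈H with walk-leaves walk s≢t
      ... | e , e∈P , e↤s = inj₂ (<-≤-trans (positive e e∈P) (term≤∑-if (src G) f e↤s))
      t∈H : HVertex t
      t∈H with walk-enters walk s≢t
      ... | e , e∈P , e↦t = inj₁ (<-≤-trans (positive e e∈P) (term≤∑-if (tgt G) f e↦t))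

    ∈fwidth-path⇒flow>0 : ∀ {k} (P : Fin k → List (Edge G)) →
      (∀ e → ∑ k (λ i → ind G (P i) e) ≤ f e) → ∀ i e → e ∈ P i → 0 < f e
    ∈fwidth-path⇒flow>0 P bound i e e∈P =
      ≤-trans (≤-reflexive (sym (∈⇒ind≡1 e∈P))) (≤-trans (term≤∑ (λ j → ind G (P j) e) i) (bound e))

    width≤fwidth : IsDAGst G s t → MinLe (WidthWitness G f) (FWidthWitness G s t f)
    width≤fwidth (acyclic , _ , source , _ , sink) k (P , paths , cover , bound) with s Fin.≟ t
    ... | yes refl = 0 , ((λ ()) , (λ ()) , λ e p → ⊥-elim (flow-vanishes e p)) , z≤n
      where
      flow-vanishes : ∀ e → ¬ (0 < f e)
      flow-vanishes e p with cover e p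
      ... | i , e∈P = ¬Any[] (subst (e ∈_) (acyclic s (P i) (paths i)) e∈P)
    ... | no s≢t =
      k , (P , (λ i → stWalk⇒HPath source sink s≢t (paths i) (∈fwidth-path⇒flow>0 P bound i)) , cover) , ≤-refl

    fwidth≤mfd : MinLe (FWidthWitness G s t f) (MFDWitness G s t f)
    fwidth≤mfd k (P , w , paths , decomposition) = size , (P ∘ index , paths ∘ index , cover , bound) , size≤
      where
      open SupportEnumeration (enumerate-support k w)
      cover : ∀ e → 0 < f e → ∃ λ j → e ∈ P (index j)
      cover e p with ∑>0⇒∃term>0 k (λ i → w i * ind G (P i) e) (subst (0 <_) (decomposition e) p)
      ... | i , wi*ind>0 with covers i (m*n>0⇒m>0 (w i) _ wi*ind>0)
      ... | j , refl = j , ind>0⇒∈ (P i) (m*n>0⇒n>0 (w i) _ wi*ind>0)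
      bound : ∀ e → ∑ size (λ j → ind G (P (index j)) e) ≤ f e
      bound e = ≤-trans (∑≤weighted (λ i → ind G (P i) e)) (≤-reflexive (sym (decomposition e)))

  fwidth-antitone : ∀ s t (f g : FlowFn G) → _≤F_ G f g →
    (∀ e → FlowSubgraph.HEdge G f e ⇔ FlowSubgraph.HEdge G g e) →
    MinLe (FWidthWitness G s t g) (FWidthWitness G s t f)
  fwidth-antitone s t f g f≤g same-edges k (P , paths , cover , bound) =
    k , (P , paths , (λ e p → cover e (Equivalence.from (same-edges e) p)) , (λ e → ≤-trans (bound e) (f≤g e))) , ≤-refl

lemma13 : (G : Multigraph) (s t : Vertex G) → IsDAGst G s t →
    ((f : FlowFn G) → IsFlow G s t f →
      MinLe (WidthWitness G f) (FWidthWitness G s t f)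
      × MinLe (FWidthWitness G s t f) (MFDWitness G s t f))
    × ((f g : FlowFn G) → IsFlow G s t f → IsFlow G s t g → _≤F_ G f g →
      (∀ e → FlowSubgraph.HEdge G f e ⇔ FlowSubgraph.HEdge G g e) →
      (∀ v → FlowSubgraph.HVertex G f v ⇔ FlowSubgraph.HVertex G g v) →
      MinLe (FWidthWitness G s t g) (FWidthWitness G s t f))
lemma13 G s t dag =
  (λ f _ → width≤fwidth G s t f dag , fwidth≤mfd G s t f) ,
  (λ f g _ _ f≤g same-edges _ → fwidth-antitone G s t f g f≤g same-edges)
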